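{- Let $G_{2,5}$ be a nearly regular $2$-balanced $5$-partite tournament with partite sets $V_{i} = \{v_{i,1}, v_{i,2} \}, i\in [5]$. For any regular or semi-regular partite set $V_i$ of $G_{2,5}$, if $n(V_i)=4$, then $V_i$ controls-2 some partite set $V_j$ with $j\ne i$ (written $V_i \stackrel{2}{\to} V_j$).
   Context: A $2$-balanced $5$-partite tournament $G_{2,5}$ is an orientation of the complete $5$-partite graph whose five partite sets all have size $2$; it is nearly regular if $|d^{+}(v)-d^{ - }(v)|\le 2$ for every vertex $v$. A vertex is regular if $d^+(v)=d^-(v)$, otherwise irregular; a partite set $V_i$ is regular if both its vertices are regular, semi-regular if exactly one of its vertices is regular. A partition of $G_{2,5}$ into maximal tournaments is a partition of the vertex set into two vertex-disjoint tournaments of order $5$ (each containing exactly one vertex of every partite set); such a partition is non-strong if at least one of the two tournaments is not strongly connected. For a vertex $u$ and partition $\tau$, $T_{u,\tau}$ is the tournament of $\tau$ containing $u$, and $\delta_{T}(u)=\min\{d^+_T(u),d^-_T(u)\}$. $n(V_i)$ is the number of non-strong partitions $\tau$ such that some $u\in V_i$ has $\delta_{T_{u,\tau}}(u)=0$. For distinct partite sets, $V_i$ controls-2 $V_j$ if there are exactly two arcs from $V_i$ to $V_j$ and $|N^{+}(v_{j,1}) \cap V_i| \neq 1$, $|N^{+}(v_{j,2}) \cap V_i| \neq 1$ (i.e. one vertex of $V_j$ dominates both vertices of $V_i$ and the other is dominated by both). -}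

module Defs where

open import Data.Nat using (ℕ; zero; suc; _+_; _≤_)
open import Data.Bool using (Bool; true; false; not; if_then_else_; _∧_)
open import Data.Fin using (Fin; zero; suc)
open import Data.Fin.Properties using (_≟_)
open import Data.Product using (_×_; _,_; proj₁; proj₂; Σ; ∃)
open import Data.Sum using (_⊎_)
open import Data.List using (List; length; map; allFin; cartesianProduct)
open import Data.Nat.ListAction using (sum)
open import Data.List.Relation.Unary.Unique.Propositional using (Unique)
open import Data.List.Membership.Propositional using (_∈_)
open import Data.Vec using (Vec; lookup)
open import Relation.Binary.PropositionalEquality using (_≡_; _≢_)
open import Relation.Nullary using (¬_)
open import Relation.Nullary.Decidable using (⌊_⌋)
open import Function.Bundles using (_⇔_)

-- Vertices of G_{2,5}: v_{i,a} is (i , a), i : Fin 5 (partite set), a : Fin 2.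
Vertex : Set
Vertex = Fin 5 × Fin 2

allVertices : List Vertex
allVertices = cartesianProduct (allFin 5) (allFin 2)

count : (Vertex → Bool) → ℕ
count p = sum (map (λ v → if p v then 1 else 0) allVertices)

-- An orientation of the complete 5-partite graph K_{2,2,2,2,2}:
-- arc u v = true  iff  u → v.  No arcs inside a partite set; between
-- different partite sets exactly one of the two directions.
record G25 : Set where
  field
    arc : Vertex → Vertex → Bool
    no-arc-inside : ∀ i a b → arc (i , a) (i , b) ≡ false
    tournament : ∀ i j a b → i ≢ j → arc (i , a) (j , b) ≡ not (arc (j , b) (i , a))
open G25 public

outdeg indeg : G25 → Vertex → ℕ
outdeg G v = count (λ w → arc G v w)
indeg  G v = count (λ w → arc G w v)

NearlyRegular : G25 → Set
NearlyRegular G = ∀ v → (outdeg G v ≤ indeg G v + 2) × (indeg G v ≤ outdeg G v + 2)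

RegularVertex : G25 → Vertex → Set
RegularVertex G v = outdeg G v ≡ indeg G v

RegularSet : G25 → Fin 5 → Set
RegularSet G i = RegularVertex G (i , zero) × RegularVertex G (i , suc zero)

SemiRegularSet : G25 → Fin 5 → Set
SemiRegularSet G i =
  (RegularVertex G (i , zero) × ¬ RegularVertex G (i , suc zero)) ⊎
  (¬ RegularVertex G (i , zero) × RegularVertex G (i , suc zero))

-- Partitions into two maximal tournaments (unordered pair {T_A, T_B}).
-- Canonical representative: T_A contains v_{0,0}; τ lists, for partite
-- sets 1..4, which vertex lies in T_A.  This is a bijection with the 16
-- partitions.
Partition : Set
Partition = Vec (Fin 2) 4

choice : Partition → Fin 5 → Fin 2
choice τ zero    = zero
choice τ (suc j) = lookup τ j

inA : Partition → Vertex → Bool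
inA τ (i , a) = ⌊ a ≟ choice τ i ⌋

_==_ : Bool → Bool → Bool
true  == b = b
false == b = not b

-- membership in T_{u,τ}, the tournament of τ containing u
inT : Partition → Vertex → Vertex → Bool
inT τ u w = inA τ w == inA τ u

data Walk (G : G25) (S : Vertex → Bool) : Vertex → Vertex → Set where
  here : ∀ {u} → Walk G S u u
  step : ∀ {u w v} → S w ≡ true → arc G u w ≡ true → Walk G S w v → Walk G S u v

StronglyConnected : G25 → (Vertex → Bool) → Set
StronglyConnected G S = ∀ u v → S u ≡ true → S v ≡ true → Walk G S u v

NonStrong : G25 → Partition → Set
NonStrong G τ = ¬ StronglyConnected G (inT τ (zero , zero))
              ⊎ ¬ StronglyConnected G (λ w → not (inA τ w))

outdegT indegT : G25 → Partition → Vertex → ℕ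
outdegT G τ u = count (λ w → inT τ u w ∧ arc G u w)
indegT  G τ u = count (λ w → inT τ u w ∧ arc G w u)

DeltaZero : G25 → Partition → Vertex → Set
DeltaZero G τ u = (outdegT G τ u ≡ 0) ⊎ (indegT G τ u ≡ 0)

Counted : G25 → Fin 5 → Partition → Set
Counted G i τ = NonStrong G τ × ∃ λ (a : Fin 2) → DeltaZero G τ (i , a)

HasCount : (Partition → Set) → ℕ → Set
HasCount P k = Σ (List Partition) λ l →
  (length l ≡ k) × Unique l × (∀ τ → (τ ∈ l) ⇔ P τ)

nV≡ : G25 → Fin 5 → ℕ → Set
nV≡ G i k = HasCount (Counted G i) k

b2n : Bool → ℕ
b2n true  = 1
b2n false = 0

arcsFrom : G25 → Fin 5 → Fin 5 → ℕ
arcsFrom G i j = b2n (arc G (i , zero) (j , zero)) + b2n (arc G (i , zero) (j , suc zero))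
               + b2n (arc G (i , suc zero) (j , zero)) + b2n (arc G (i , suc zero) (j , suc zero))

outInto : G25 → Vertex → Fin 5 → ℕ
outInto G v i = b2n (arc G v (i , zero)) + b2n (arc G v (i , suc zero))

Controls2 : G25 → Fin 5 → Fin 5 → Set
Controls2 G i j = (i ≢ j) × (arcsFrom G i j ≡ 2)
  × (outInto G (j , zero) i ≢ 1) × (outInto G (j , suc zero) i ≢ 1)

-- Everything in the statement depends only on the star of V_i, the sixteen arcs between
-- V_i and the other partite sets.  A vertex with δ = 0 in its tournament already makes the
-- partition non-strong, so n(V_i) counts the partitions in which a vertex of V_i is a sink or
-- a source of its tournament; re-encoding each partition by the tournament of v_{i,0}
-- turns this into a count over sixteen choice vectors that only involves the star.  The
-- theorem thus becomes a statement about the 2¹⁶ possible stars, which is decided by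
-- evaluation.
module Submission where

open import Defs
open import Data.Bool using (Bool; true; false; not; _∧_; if_then_else_)
open import Data.Bool.Properties using (∧-zeroʳ; not-involutive) renaming (_≟_ to _≟ᵇ_)
open import Data.Fin using (Fin; zero; suc; punchIn; punchOut)
open import Data.Fin.Properties using (_≟_; all?; any?; punchInᵢ≢i; punchIn-punchOut)
open import Data.List using (List; []; _∷_; map; length; allFin; cartesianProduct; cartesianProductWith; filter)
open import Data.List.Membership.Propositional using (_∈_)
open import Data.List.Membership.Propositional.Properties
  using (∈-allFin; ∈-cartesianProduct⁺; ∈-cartesianProductWith⁺; ∈-map⁺; ∈-map⁻; ∈-filter⁺; ∈-filter⁻)
open import Data.List.Membership.Propositional.Properties.WithK using (unique∧set⇒bag)
open import Data.List.Properties using (map-cong; length-map)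
open import Data.List.Relation.Binary.BagAndSetEquality using (∼bag⇒↭)
open import Data.List.Relation.Binary.Permutation.Propositional.Properties using (↭-length)
open import Data.List.Relation.Unary.All using (All; [])
open import Data.List.Relation.Unary.AllPairs using ([]; _∷_)
import Data.List.Relation.Unary.All as All
open import Data.List.Relation.Unary.Any using (here; there)
open import Data.List.Relation.Unary.Unique.Propositional using (Unique)
import Data.List.Relation.Unary.Unique.Propositional.Properties as Unique
open import Data.Nat as ℕ using (ℕ; zero; suc; _+_; _≤_)
open import Data.Nat.ListAction using (sum)
open import Data.Product using (_×_; _,_; proj₁; proj₂; ∃)
import Data.Product as Product
open import Data.Sum using (_⊎_; inj₁; inj₂; [_,_]′)
import Data.Sum as Sum
open import Data.Sum.Function.Propositional using (_⊎-cong_)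
open import Data.Vec using (Vec; []; _∷_; lookup; tabulate; insertAt)
open import Data.Vec.Properties using (∷-injective; lookup∘tabulate; tabulate∘lookup; tabulate-cong; insertAt-lookup; insertAt-punchIn)
open import Function using (_∘_; id)
open import Function.Bundles using (_⇔_; mk⇔; Equivalence)
open import Function.Properties.Equivalence using () renaming (trans to ⇔-trans)
open import Relation.Binary.PropositionalEquality using (_≡_; _≢_; _≗_; refl; sym; trans; cong; cong₂; subst; subst₂; module ≡-Reasoning)
open import Relation.Nullary using (Dec; yes; no; ¬_; ¬?; contradiction)
open import Relation.Nullary.Decidable using (⌊_⌋; _×-dec_; _⊎-dec_; toWitness; dec-true; dec-false; isYes≗does)
open import Relation.Unary using (Decidable)

open Equivalence using (to; from)

vectors : {A : Set} → List A → (n : ℕ) → List (Vec A n)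
vectors xs zero    = [] ∷ []
vectors xs (suc n) = cartesianProductWith _∷_ xs (vectors xs n)

∈-vectors : {A : Set} {xs : List A} → (∀ x → x ∈ xs) → ∀ {n} (v : Vec A n) → v ∈ vectors xs n
∈-vectors _   []       = here refl
∈-vectors ∈xs (x ∷ v) = ∈-cartesianProductWith⁺ _∷_ (∈xs x) (∈-vectors ∈xs v)

vectors-unique : {A : Set} {xs : List A} → Unique xs → ∀ n → Unique (vectors xs n)
vectors-unique u zero    = [] ∷ []
vectors-unique u (suc n) = Unique.cartesianProductWith⁺ _∷_ ∷-injective u (vectors-unique u n)

unique-length : {A : Set} {xs ys : List A} → Unique xs → Unique ys →
                (∀ {x} → x ∈ xs ⇔ x ∈ ys) → length xs ≡ length ys
unique-length uxs uys xs⇔ys = ↭-length (∼bag⇒↭ (unique∧set⇒bag uxs uys xs⇔ys))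

infixl 6 _⊕_
_⊕_ : Fin 2 → Fin 2 → Fin 2
zero     ⊕ b        = b
suc zero ⊕ zero     = suc zero
suc zero ⊕ suc zero = zero

⊕-self : ∀ x → x ⊕ x ≡ zero
⊕-self zero       = refl
⊕-self (suc zero) = refl

⊕-identityʳ : ∀ x → x ⊕ zero ≡ x
⊕-identityʳ zero       = refl
⊕-identityʳ (suc zero) = refl

⊕-cancelʳ : ∀ x y z → x ⊕ z ⊕ (y ⊕ z) ≡ x ⊕ y
⊕-cancelʳ zero       zero       zero       = refl
⊕-cancelʳ zero       zero       (suc zero) = refl
⊕-cancelʳ zero       (suc zero) zero       = refl
⊕-cancelʳ zero       (suc zero) (suc zero) = refl
⊕-cancelʳ (suc zero) zero       zero       = refl
⊕-cancelʳ (suc zero) zero       (suc zero) = refl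
⊕-cancelʳ (suc zero) (suc zero) zero       = refl
⊕-cancelʳ (suc zero) (suc zero) (suc zero) = refl

==-≟ : ∀ (a b c d : Fin 2) → (⌊ b ≟ c ⌋ == ⌊ a ≟ d ⌋) ≡ ⌊ b ≟ c ⊕ d ⊕ a ⌋
==-≟ zero       zero       zero       zero       = refl
==-≟ zero       zero       zero       (suc zero) = refl
==-≟ zero       zero       (suc zero) zero       = refl
==-≟ zero       zero       (suc zero) (suc zero) = refl
==-≟ zero       (suc zero) zero       zero       = refl
==-≟ zero       (suc zero) zero       (suc zero) = refl
==-≟ zero       (suc zero) (suc zero) zero       = refl
==-≟ zero       (suc zero) (suc zero) (suc zero) = refl
==-≟ (suc zero) zero       zero       zero       = refl
==-≟ (suc zero) zero       zero       (suc zero) = refl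
==-≟ (suc zero) zero       (suc zero) zero       = refl
==-≟ (suc zero) zero       (suc zero) (suc zero) = refl
==-≟ (suc zero) (suc zero) zero       zero       = refl
==-≟ (suc zero) (suc zero) zero       (suc zero) = refl
==-≟ (suc zero) (suc zero) (suc zero) zero       = refl
==-≟ (suc zero) (suc zero) (suc zero) (suc zero) = refl

==-refl : ∀ x → (x == x) ≡ true
==-refl true  = refl
==-refl false = refl

==-false : ∀ x → (x == false) ≡ not x
==-false true  = refl
==-false false = refl

≟-refl : ∀ {n} (x : Fin n) → ⌊ x ≟ x ⌋ ≡ true
≟-refl x = trans (isYes≗does (x ≟ x)) (dec-true (x ≟ x) refl)

≟-≢ : ∀ {n} {x y : Fin n} → x ≢ y → ⌊ x ≟ y ⌋ ≡ false
≟-≢ {x = x} {y} x≢y = trans (isYes≗does (x ≟ y)) (dec-false (x ≟ y) x≢y)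

punchIn-cover : ∀ {n} (i : Fin (suc n)) x → x ≡ i ⊎ ∃ λ k → x ≡ punchIn i k
punchIn-cover i x with x ≟ i
... | yes x≡i = inj₁ x≡i
... | no  x≢i = inj₂ (punchOut (x≢i ∘ sym) , sym (punchIn-punchOut (x≢i ∘ sym)))

indicatorSum : {A : Set} → (A → Bool) → List A → ℕ
indicatorSum p xs = sum (map (λ v → if p v then 1 else 0) xs)

module _ {A : Set} (p : A → Bool) where

  indicatorSum≡0⇒ : ∀ xs → indicatorSum p xs ≡ 0 → ∀ {x} → x ∈ xs → p x ≡ false
  indicatorSum≡0⇒ (y ∷ ys) sum≡0 (here refl) with p y
  ... | false = refl
  indicatorSum≡0⇒ (y ∷ ys) sum≡0 (there x∈ys) with p y
  ... | false = indicatorSum≡0⇒ ys sum≡0 x∈ys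

  indicatorSum≡0⇐ : ∀ xs → (∀ x → p x ≡ false) → indicatorSum p xs ≡ 0
  indicatorSum≡0⇐ []       _       = refl
  indicatorSum≡0⇐ (x ∷ xs) p≡false rewrite p≡false x = indicatorSum≡0⇐ xs p≡false

indicatorSum-cong : {A : Set} {p q : A → Bool} → p ≗ q → ∀ xs → indicatorSum p xs ≡ indicatorSum q xs
indicatorSum-cong p≗q xs = cong sum (map-cong (λ v → cong (if_then 1 else 0) (p≗q v)) xs)

∈-allVertices : ∀ v → v ∈ allVertices
∈-allVertices (i , a) = ∈-cartesianProduct⁺ (∈-allFin i) (∈-allFin a)

count≡0⇔ : (p : Vertex → Bool) → count p ≡ 0 ⇔ (∀ w → p w ≡ false)
count≡0⇔ p = mk⇔ (λ count≡0 w → indicatorSum≡0⇒ p allVertices count≡0 (∈-allVertices w))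
                 (indicatorSum≡0⇐ p allVertices)

countˢ : (Fin 4 × Fin 2 → Bool) → ℕ
countˢ p = indicatorSum p (cartesianProduct (allFin 4) (allFin 2))

countˢ-cong : {p q : Fin 4 × Fin 2 → Bool} → p ≗ q → countˢ p ≡ countˢ q
countˢ-cong p≗q = indicatorSum-cong p≗q (cartesianProduct (allFin 4) (allFin 2))

count-outside : ∀ i (p : Vertex → Bool) → (∀ b → p (i , b) ≡ false) →
                count p ≡ countˢ (λ (k , b) → p (punchIn i k , b))
count-outside i p inside = trans (indicatorSum-cong p≗skip allVertices) (count-skip i)
  where
  skip : Fin 5 → Vertex → Bool
  skip j (x , b) = if ⌊ x ≟ j ⌋ then false else p (x , b)

  p≗skip : p ≗ skip i
  p≗skip (x , b) with x ≟ i
  ... | yes refl = inside b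
  ... | no  _    = refl

  count-skip : ∀ j → count (skip j) ≡ countˢ (λ (k , b) → p (punchIn j k , b))
  count-skip zero                         = refl
  count-skip (suc zero)                   = refl
  count-skip (suc (suc zero))             = refl
  count-skip (suc (suc (suc zero)))       = refl
  count-skip (suc (suc (suc (suc zero)))) = refl

-- Partitions seen from a partite set

-- The vertex of V_x lying in the same tournament of τ as v_{i,0}.
companion : Partition → Fin 5 → Fin 5 → Fin 2
companion τ i x = choice τ x ⊕ choice τ i

inT-companion : ∀ τ i a x b → inT τ (i , a) (x , b) ≡ ⌊ b ≟ companion τ i x ⊕ a ⌋
inT-companion τ i a x b = ==-≟ a b (choice τ x) (choice τ i)

-- τ re-encoded with v_{i,0} as the distinguished vertex: entry k is the vertex of
-- V_{punchIn i k} in the tournament of v_{i,0}, so that reroot zero τ ≡ τ.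
reroot : Fin 5 → Partition → Partition
reroot i τ = tabulate (companion τ i ∘ punchIn i)

unroot : Fin 5 → Partition → Partition
unroot i σ = tabulate λ j → lookup (insertAt σ i zero) (suc j) ⊕ lookup (insertAt σ i zero) zero

reroot-unroot : ∀ i σ → reroot i (unroot i σ) ≡ σ
reroot-unroot i σ = trans (tabulate-cong companion≗σ) (tabulate∘lookup σ)
  where
  open ≡-Reasoning
  ŝ : Fin 5 → Fin 2
  ŝ = lookup (insertAt σ i zero)

  choice-unroot : ∀ x → choice (unroot i σ) x ≡ ŝ x ⊕ ŝ zero
  choice-unroot zero    = sym (⊕-self (ŝ zero))
  choice-unroot (suc j) = lookup∘tabulate (λ j → ŝ (suc j) ⊕ ŝ zero) j

  companion≗σ : ∀ k → companion (unroot i σ) i (punchIn i k) ≡ lookup σ k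
  companion≗σ k = begin
    choice (unroot i σ) (punchIn i k) ⊕ choice (unroot i σ) i ≡⟨ cong₂ _⊕_ (choice-unroot (punchIn i k)) (choice-unroot i) ⟩
    ŝ (punchIn i k) ⊕ ŝ zero ⊕ (ŝ i ⊕ ŝ zero)                 ≡⟨ ⊕-cancelʳ (ŝ (punchIn i k)) (ŝ i) (ŝ zero) ⟩
    ŝ (punchIn i k) ⊕ ŝ i                                     ≡⟨ cong₂ _⊕_ (insertAt-punchIn σ i zero k) (insertAt-lookup σ i zero) ⟩
    lookup σ k ⊕ zero                                         ≡⟨ ⊕-identityʳ (lookup σ k) ⟩
    lookup σ k                                                ∎

unroot-reroot : ∀ i τ → unroot i (reroot i τ) ≡ τ
unroot-reroot i τ = trans (tabulate-cong entry≗τ) (tabulate∘lookup τ)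
  where
  open ≡-Reasoning
  ŝ : Fin 5 → Fin 2
  ŝ = lookup (insertAt (reroot i τ) i zero)

  ŝ≗companion : ∀ x → ŝ x ≡ companion τ i x
  ŝ≗companion x with punchIn-cover i x
  ... | inj₁ refl       = trans (insertAt-lookup (reroot i τ) i zero) (sym (⊕-self (choice τ i)))
  ... | inj₂ (k , refl) = trans (insertAt-punchIn (reroot i τ) i zero k) (lookup∘tabulate (companion τ i ∘ punchIn i) k)

  entry≗τ : ∀ j → ŝ (suc j) ⊕ ŝ zero ≡ lookup τ j
  entry≗τ j = begin
    ŝ (suc j) ⊕ ŝ zero                                     ≡⟨ cong₂ _⊕_ (ŝ≗companion (suc j)) (ŝ≗companion zero) ⟩
    choice τ (suc j) ⊕ choice τ i ⊕ (zero ⊕ choice τ i)   ≡⟨ ⊕-cancelʳ (lookup τ j) zero (choice τ i) ⟩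
    lookup τ j ⊕ zero                                      ≡⟨ ⊕-identityʳ (lookup τ j) ⟩
    lookup τ j                                             ∎

-- Non-strong partitions

walk-leaves : ∀ {G S u v} → Walk G S u v → u ≢ v → ∃ λ w → S w ≡ true × arc G u w ≡ true
walk-leaves here           u≢u = contradiction refl u≢u
walk-leaves (step sw uw _) _   = _ , sw , uw

walk-enters : ∀ {G S u v} → S u ≡ true → Walk G S u v → u ≡ v ⊎ ∃ λ w → S w ≡ true × arc G w v ≡ true
walk-enters su here = inj₁ refl
walk-enters su (step sw uw rest) with walk-enters sw rest
... | inj₁ refl  = inj₂ (_ , su , uw)
... | inj₂ enter = inj₂ enter

sink-or-source⇒¬strong : ∀ G (S : Vertex → Bool) {u v} → S u ≡ true → S v ≡ true → u ≢ v →
                         (∀ w → S w ∧ arc G u w ≡ false) ⊎ (∀ w → S w ∧ arc G w u ≡ false) →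
                         ¬ StronglyConnected G S
sink-or-source⇒¬strong G S su sv u≢v (inj₁ sink) strong
  with w , sw , uw ← walk-leaves (strong _ _ su sv) u≢v
  = contradiction (trans (sym (cong₂ _∧_ sw uw)) (sink w)) λ ()
sink-or-source⇒¬strong G S su sv u≢v (inj₂ source) strong
  with walk-enters sv (strong _ _ sv su)
... | inj₁ v≡u            = u≢v (sym v≡u)
... | inj₂ (w , sw , wu) = contradiction (trans (sym (cong₂ _∧_ sw wu)) (source w)) λ ()

tournament-of : ∀ τ u → inT τ (zero , zero) ≗ inT τ u ⊎ (λ w → not (inA τ w)) ≗ inT τ u
tournament-of τ u = Sum.map (_∘ inA τ) (_∘ inA τ) (==-side (inA τ u))
  where
  ==-side : ∀ x → (_== true) ≗ (_== x) ⊎ not ≗ (_== x)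
  ==-side true  = inj₁ λ _ → refl
  ==-side false = inj₂ λ y → sym (==-false y)

deltaZero⇒nonStrong : ∀ G τ i a → DeltaZero G τ (i , a) → NonStrong G τ
deltaZero⇒nonStrong G τ i a δ = Sum.map (¬strong _) (¬strong _) (tournament-of τ u)
  where
  m : Fin 2
  m = companion τ i (punchIn i zero) ⊕ a

  u v : Vertex
  u = i , a
  v = punchIn i zero , m

  v∈T : inT τ u v ≡ true
  v∈T = trans (inT-companion τ i a (punchIn i zero) m) (≟-refl m)

  u≢v : u ≢ v
  u≢v u≡v = punchInᵢ≢i i zero (sym (cong proj₁ u≡v))

  ¬strong : (S : Vertex → Bool) → S ≗ inT τ u → ¬ StronglyConnected G S
  ¬strong S S≗T = sink-or-source⇒¬strong G S (trans (S≗T u) (==-refl (inA τ u))) (trans (S≗T v) v∈T) u≢v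
    (Sum.map (λ sink w → trans (cong (_∧ _) (S≗T w)) (to (count≡0⇔ (λ w → inT τ u w ∧ arc G u w)) sink w))
             (λ source w → trans (cong (_∧ _) (S≗T w)) (to (count≡0⇔ (λ w → inT τ u w ∧ arc G w u)) source w)) δ)

-- The star of a partite set

Block : Set
Block = Vec (Vec Bool 2) 2

block : G25 → Fin 5 → Fin 5 → Block
block G i j = (arc G (i , zero) (j , zero)     ∷ arc G (i , zero) (j , suc zero)     ∷ [])
            ∷ (arc G (i , suc zero) (j , zero) ∷ arc G (i , suc zero) (j , suc zero) ∷ []) ∷ []

entry : Block → Fin 2 → Fin 2 → Bool
entry B a b = lookup (lookup B a) b

entry-block : ∀ G i j a b → entry (block G i j) a b ≡ arc G (i , a) (j , b)
entry-block G i j zero       zero       = refl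
entry-block G i j zero       (suc zero) = refl
entry-block G i j (suc zero) zero       = refl
entry-block G i j (suc zero) (suc zero) = refl

Star : Set
Star = Vec Block 4

star : G25 → Fin 5 → Star
star G i = tabulate (block G i ∘ punchIn i)

arcˢ : Star → Fin 4 → Fin 2 → Fin 2 → Bool
arcˢ S k = entry (lookup S k)

lookup-star : ∀ G i k → lookup (star G i) k ≡ block G i (punchIn i k)
lookup-star G i = lookup∘tabulate (block G i ∘ punchIn i)

arcˢ-star : ∀ G i k a b → arcˢ (star G i) k a b ≡ arc G (i , a) (punchIn i k , b)
arcˢ-star G i k a b = trans (cong (λ B → entry B a b) (lookup-star G i k)) (entry-block G i (punchIn i k) a b)

outdegˢ indegˢ : Star → Fin 2 → ℕ
outdegˢ S a = countˢ (λ (k , b) → arcˢ S k a b)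
indegˢ  S a = countˢ (λ (k , b) → not (arcˢ S k a b))

outdeg-star : ∀ G i a → outdeg G (i , a) ≡ outdegˢ (star G i) a
outdeg-star G i a = trans (count-outside i (arc G (i , a)) (no-arc-inside G i a))
                          (countˢ-cong λ (k , b) → sym (arcˢ-star G i k a b))

indeg-star : ∀ G i a → indeg G (i , a) ≡ indegˢ (star G i) a
indeg-star G i a = trans (count-outside i (λ w → arc G w (i , a)) (λ b → no-arc-inside G i b a))
                         (countˢ-cong λ (k , b) → trans (tournament G (punchIn i k) i b a (punchInᵢ≢i i k))
                                                         (cong not (sym (arcˢ-star G i k a b))))

arcCount : Block → ℕ
arcCount B = b2n (entry B zero zero) + b2n (entry B zero (suc zero))
           + b2n (entry B (suc zero) zero) + b2n (entry B (suc zero) (suc zero))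

backCount : Block → Fin 2 → ℕ
backCount B b = b2n (not (entry B zero b)) + b2n (not (entry B (suc zero) b))

Controls2ᵇ : Block → Set
Controls2ᵇ B = (arcCount B ≡ 2) × (backCount B zero ≢ 1) × (backCount B (suc zero) ≢ 1)

controls2? : ∀ B → Dec (Controls2ᵇ B)
controls2? B = arcCount B ℕ.≟ 2 ×-dec ¬? (backCount B zero ℕ.≟ 1) ×-dec ¬? (backCount B (suc zero) ℕ.≟ 1)

controls2-block : ∀ G i j → i ≢ j → Controls2ᵇ (block G i j) → Controls2 G i j
controls2-block G i j i≢j (two , back₀ , back₁) =
  i≢j , two , subst (_≢ 1) (sym (outInto-block zero)) back₀ , subst (_≢ 1) (sym (outInto-block (suc zero))) back₁
  where
  back-arc : ∀ a b → b2n (arc G (j , b) (i , a)) ≡ b2n (not (entry (block G i j) a b))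
  back-arc a b = cong b2n (trans (tournament G j i b a (i≢j ∘ sym)) (cong not (sym (entry-block G i j a b))))

  outInto-block : ∀ b → outInto G (j , b) i ≡ backCount (block G i j) b
  outInto-block b = cong₂ _+_ (back-arc zero b) (back-arc (suc zero) b)

-- For σ = reroot i τ, the tournament of v_{i,a} meets V_{punchIn i k} in σ_k ⊕ a.
Isolatedˢ : Star → Partition → Fin 2 → Set
Isolatedˢ S σ a = (∀ k → arcˢ S k a (lookup σ k ⊕ a) ≡ false) ⊎ (∀ k → arcˢ S k a (lookup σ k ⊕ a) ≡ true)

isolated? : ∀ S σ a → Dec (Isolatedˢ S σ a)
isolated? S σ a = all? (λ k → arcˢ S k a (lookup σ k ⊕ a) ≟ᵇ false)
           ⊎-dec all? (λ k → arcˢ S k a (lookup σ k ⊕ a) ≟ᵇ true)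

Countedˢ : Star → Partition → Set
Countedˢ S σ = ∃ λ a → Isolatedˢ S σ a

counted? : ∀ S σ → Dec (Countedˢ S σ)
counted? S σ = any? (isolated? S σ)

tournament-avoids : ∀ τ i a (q : Vertex → Bool) → (∀ b → q (i , b) ≡ false) →
                    (∀ w → inT τ (i , a) w ∧ q w ≡ false) ⇔
                    (∀ k → q (punchIn i k , lookup (reroot i τ) k ⊕ a) ≡ false)
tournament-avoids τ i a q inside = mk⇔ at-companions everywhere
  where
  m : Fin 4 → Fin 2
  m k = lookup (reroot i τ) k ⊕ a

  inT-punchIn : ∀ k b → inT τ (i , a) (punchIn i k , b) ≡ ⌊ b ≟ m k ⌋
  inT-punchIn k b = trans (inT-companion τ i a (punchIn i k) b)
                          (cong (λ c → ⌊ b ≟ c ⊕ a ⌋) (sym (lookup∘tabulate (companion τ i ∘ punchIn i) k)))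

  at-companions : (∀ w → inT τ (i , a) w ∧ q w ≡ false) → ∀ k → q (punchIn i k , m k) ≡ false
  at-companions avoid k = trans (cong (_∧ q (punchIn i k , m k)) (sym (trans (inT-punchIn k (m k)) (≟-refl (m k)))))
                                (avoid (punchIn i k , m k))

  everywhere : (∀ k → q (punchIn i k , m k) ≡ false) → ∀ w → inT τ (i , a) w ∧ q w ≡ false
  everywhere avoid (x , b) with punchIn-cover i x
  ... | inj₁ refl = trans (cong (inT τ (i , a) (i , b) ∧_) (inside b)) (∧-zeroʳ _)
  ... | inj₂ (k , refl) with b ≟ m k
  ...   | yes refl = trans (cong (inT τ (i , a) (punchIn i k , b) ∧_) (avoid k)) (∧-zeroʳ _)
  ...   | no  b≢m  = cong (_∧ q (punchIn i k , b)) (trans (inT-punchIn k b) (≟-≢ b≢m))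

deltaZero⇔isolated : ∀ G τ i a → DeltaZero G τ (i , a) ⇔ Isolatedˢ (star G i) (reroot i τ) a
deltaZero⇔isolated G τ i a = sink ⊎-cong source
  where
  m : Fin 4 → Fin 2
  m k = lookup (reroot i τ) k ⊕ a

  sink : outdegT G τ (i , a) ≡ 0 ⇔ (∀ k → arcˢ (star G i) k a (m k) ≡ false)
  sink = ⇔-trans (count≡0⇔ _) (⇔-trans (tournament-avoids τ i a (arc G (i , a)) (no-arc-inside G i a))
           (mk⇔ (λ h k → trans (arcˢ-star G i k a (m k)) (h k))
                (λ h k → trans (sym (arcˢ-star G i k a (m k))) (h k))))

  arc-in : ∀ k → arc G (punchIn i k , m k) (i , a) ≡ not (arcˢ (star G i) k a (m k))
  arc-in k = trans (tournament G (punchIn i k) i (m k) a (punchInᵢ≢i i k)) (cong not (sym (arcˢ-star G i k a (m k))))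

  source : indegT G τ (i , a) ≡ 0 ⇔ (∀ k → arcˢ (star G i) k a (m k) ≡ true)
  source = ⇔-trans (count≡0⇔ _) (⇔-trans (tournament-avoids τ i a (λ w → arc G w (i , a)) (λ b → no-arc-inside G i b a))
             (mk⇔ (λ h k → trans (sym (not-involutive _)) (cong not (trans (sym (arc-in k)) (h k))))
                  (λ h k → trans (arc-in k) (cong not (h k)))))

counted⇔ : ∀ G i τ → Counted G i τ ⇔ Countedˢ (star G i) (reroot i τ)
counted⇔ G i τ = mk⇔ (λ (_ , a , δ) → a , to (deltaZero⇔isolated G τ i a) δ)
                     (λ (a , isolated) → let δ = from (deltaZero⇔isolated G τ i a) isolated
                                         in deltaZero⇒nonStrong G τ i a δ , a , δ)

-- Counting partitions

partitions : List Partition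
partitions = vectors (allFin 2) 4

HasCount-bijection : ∀ {P Q : Partition → Set} {k} (f g : Partition → Partition) →
                     (∀ σ → f (g σ) ≡ σ) → (∀ τ → g (f τ) ≡ τ) → (∀ τ → P τ ⇔ Q (f τ)) →
                     HasCount P k → HasCount Q k
HasCount-bijection {Q = Q} f g fg≗id gf≗id P⇔Q (l , l≡k , unique-l , l⇔P) =
  map f l , trans (length-map f l) l≡k , Unique.map⁺ f-injective unique-l , λ σ → mk⇔ (fl⇒Q σ) (Q⇒fl σ)
  where
  f-injective : ∀ {τ τ′} → f τ ≡ f τ′ → τ ≡ τ′
  f-injective {τ} {τ′} fτ≡fτ′ = trans (sym (gf≗id τ)) (trans (cong g fτ≡fτ′) (gf≗id τ′))

  fl⇒Q : ∀ σ → σ ∈ map f l → Q σ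
  fl⇒Q σ σ∈fl with τ , τ∈l , refl ← ∈-map⁻ f σ∈fl = to (P⇔Q τ) (to (l⇔P τ) τ∈l)

  Q⇒fl : ∀ σ → Q σ → σ ∈ map f l
  Q⇒fl σ Qσ = subst (_∈ map f l) (fg≗id σ)
    (∈-map⁺ f (from (l⇔P (g σ)) (from (P⇔Q (g σ)) (subst Q (sym (fg≗id σ)) Qσ))))

HasCount⇒length-filter : ∀ {P} (P? : Decidable P) {k} → HasCount P k → length (filter P? partitions) ≡ k
HasCount⇒length-filter P? (l , l≡k , unique-l , l⇔P) = trans (sym l≡filter) l≡k
  where
  l≡filter : length l ≡ length (filter P? partitions)
  l≡filter = unique-length unique-l (Unique.filter⁺ P? (vectors-unique (Unique.allFin⁺ 2) 4))
    λ {τ} → mk⇔ (λ τ∈l → ∈-filter⁺ P? (∈-vectors ∈-allFin τ) (to (l⇔P τ) τ∈l))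
                (λ τ∈filter → from (l⇔P τ) (proj₂ (∈-filter⁻ P? τ∈filter)))

-- The finite check

RegularAt NearlyRegularAt : Star → Fin 2 → Set
RegularAt S a = outdegˢ S a ≡ indegˢ S a
NearlyRegularAt S a = (outdegˢ S a ≤ indegˢ S a + 2) × (indegˢ S a ≤ outdegˢ S a + 2)

nˢ : Star → ℕ
nˢ S = length (filter (counted? S) partitions)

StarHypotheses : Star → Set
StarHypotheses S = (RegularAt S zero ⊎ RegularAt S (suc zero))
                 × (NearlyRegularAt S zero × NearlyRegularAt S (suc zero))
                 × nˢ S ≡ 4

starHypotheses? : ∀ S → Dec (StarHypotheses S)
starHypotheses? S = (regular? zero ⊎-dec regular? (suc zero))
                ×-dec (nearlyRegular? zero ×-dec nearlyRegular? (suc zero))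
                ×-dec nˢ S ℕ.≟ 4
  where
  regular? : ∀ a → Dec (RegularAt S a)
  regular? a = outdegˢ S a ℕ.≟ indegˢ S a
  nearlyRegular? : ∀ a → Dec (NearlyRegularAt S a)
  nearlyRegular? a = (outdegˢ S a ℕ.≤? indegˢ S a + 2) ×-dec (indegˢ S a ℕ.≤? outdegˢ S a + 2)

stars : List Star
stars = vectors (vectors (vectors (true ∷ false ∷ []) 2) 2) 4

∈-stars : ∀ S → S ∈ stars
∈-stars = ∈-vectors (∈-vectors (∈-vectors ∈-bool))
  where
  ∈-bool : ∀ x → x ∈ true ∷ false ∷ []
  ∈-bool true  = here refl
  ∈-bool false = there (here refl)

-- The conclusion is decided first: whenever it holds, ⊎-dec skips the costly hypotheses.
star-check : All (λ S → (∃ λ k → Controls2ᵇ (lookup S k)) ⊎ ¬ StarHypotheses S) stars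
star-check = toWitness {a? = All.all? (λ S → any? (controls2? ∘ lookup S) ⊎-dec ¬? (starHypotheses? S)) stars} _

star-controls2 : ∀ S → StarHypotheses S → ∃ λ k → Controls2ᵇ (lookup S k)
star-controls2 S hypotheses = [ id , contradiction hypotheses ]′ (All.lookup star-check (∈-stars S))

regular-star : ∀ G i a → RegularVertex G (i , a) → RegularAt (star G i) a
regular-star G i a regular = trans (sym (outdeg-star G i a)) (trans regular (indeg-star G i a))

nearlyRegular-star : ∀ G → NearlyRegular G → ∀ i a → NearlyRegularAt (star G i) a
nearlyRegular-star G nearlyRegular i a =
  subst₂ (λ out in′ → (out ≤ in′ + 2) × (in′ ≤ out + 2)) (outdeg-star G i a) (indeg-star G i a) (nearlyRegular (i , a))

someRegular-star : ∀ G i → RegularSet G i ⊎ SemiRegularSet G i →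
                   RegularAt (star G i) zero ⊎ RegularAt (star G i) (suc zero)
someRegular-star G i (inj₁ (regular₀ , _))        = inj₁ (regular-star G i zero regular₀)
someRegular-star G i (inj₂ (inj₁ (regular₀ , _))) = inj₁ (regular-star G i zero regular₀)
someRegular-star G i (inj₂ (inj₂ (_ , regular₁))) = inj₂ (regular-star G i (suc zero) regular₁)

controls2-star : ∀ G i k → Controls2ᵇ (lookup (star G i) k) → Controls2 G i (punchIn i k)
controls2-star G i k = controls2-block G i (punchIn i k) (punchInᵢ≢i i k ∘ sym) ∘ subst Controls2ᵇ (lookup-star G i k)

nˢ-star : ∀ G i {k} → nV≡ G i k → nˢ (star G i) ≡ k
nˢ-star G i = HasCount⇒length-filter (counted? (star G i))
            ∘ HasCount-bijection (reroot i) (unroot i) (reroot-unroot i) (unroot-reroot i) (counted⇔ G i)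

lemma2p7 : (G : G25) → NearlyRegular G → (i : Fin 5) →
    RegularSet G i ⊎ SemiRegularSet G i → nV≡ G i 4 →
    ∃ λ (j : Fin 5) → Controls2 G i j
lemma2p7 G nearlyRegular i regularOrSemi n≡4 =
  Product.map (punchIn i) (λ {k} → controls2-star G i k) (star-controls2 (star G i) hypotheses)
  where
  hypotheses : StarHypotheses (star G i)
  hypotheses = someRegular-star G i regularOrSemi
             , (nearlyRegular-star G nearlyRegular i zero , nearlyRegular-star G nearlyRegular i (suc zero))
             , nˢ-star G i n≡4
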